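{- Let $\mathbf{L}=\langle L,G,H,F,P\rangle$ be a tense ICRDL-algebra. Then the map $\alpha_L\colon L\to C(K(L))$ given by $\alpha_L(x)=(x,0)$ is an isomorphism of tense ICRDL-algebras.
   Context: An ICRDL-algebra is a structure $\langle L,\vee,\wedge,\cdot,\to,0,1\rangle$ such that $\langle L,\vee,\wedge,0,1\rangle$ is a bounded distributive lattice, $\langle L,\cdot,1\rangle$ is a commutative monoid, and $x\cdot y\le z$ iff $x\le y\to z$. A tense ICRDL-algebra is an ICRDL-algebra with unary operations $G,H,F,P$ satisfying: (T1) $P(x)\le y$ iff $x\le G(y)$; (T2) $F(x)\le y$ iff $x\le H(y)$; (T3) $G(0)=0$, $H(0)=0$; (T4) $G(x)\cdot F(y)\le F(x\cdot y)$ and $H(x)\cdot P(y)\le P(x\cdot y)$; (T5) $G(x\vee y)\le G(x)\vee F(y)$ and $H(x\vee y)\le H(x)\vee P(y)$; (T6) $G(x\to y)\le G(x)\to G(y)$ and $H(x\to y)\le H(x)\to H(y)$. $K(L)=\{(a,b)\in L\times L:a\cdot b=0\}$ is the tense DRL-algebra with $(a,b)\vee(x,y)=(a\vee x,b\wedge y)$, $(a,b)\wedge(x,y)=(a\wedge x,b\vee y)$, $(a,b)\ast(x,y)=(a\cdot x,(a\to y)\wedge(x\to b))$, $\sim(a,b)=(b,a)$, $0=(0,1)$, $1=(1,0)$, $c=(0,0)$, $G_K(a,b)=(G(a),F(b))$, $H_K(a,b)=(H(a),P(b))$, and hence $F_K(a,b)=(F(a),G(b))$, $P_K(a,b)=(P(a),H(b))$.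 For a structure $A$ of this kind, $C(A)=\{x\in A:x\ge c\}$ is the tense ICRDL-algebra with the lattice operations of $A$, $x\cdot y=(x\ast y)\vee c$, $x\to y=\sim(x\ast(\sim y))$, bottom $c$, top $1$, and tense operators the restrictions of $G_K,H_K,F_K,P_K$. -}

module Defs where

open import Level using (Level; suc; _⊔_)
open import Data.Product using (Σ; _×_; _,_; proj₁; proj₂; ∃)
open import Function.Bundles using (_⇔_)
open import Relation.Binary.PropositionalEquality using (_≡_)
open import Algebra.Core using (Op₁; Op₂)
open import Algebra.Structures using (IsCommutativeMonoid)
open import Algebra.Lattice.Structures using (IsDistributiveLattice)
open import Algebra.Definitions using (Identity)

record TenseICRDL (ℓ : Level) : Set (suc ℓ) where
  infixr 6 _∨_
  infixr 7 _∧_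
  infixr 8 _·_
  infixr 5 _⇒_
  infix 4 _≤_
  field
    Carrier : Set ℓ
    _∨_ _∧_ _·_ _⇒_ : Op₂ Carrier
    𝟘 𝟙 : Carrier
    G H F P : Op₁ Carrier

  _≤_ : Carrier → Carrier → Set ℓ
  x ≤ y = x ∨ y ≡ y

  field
    isDistributiveLattice : IsDistributiveLattice _≡_ _∨_ _∧_
    ∨-identity : Identity _≡_ 𝟘 _∨_
    ∧-identity : Identity _≡_ 𝟙 _∧_
    isCommutativeMonoid : IsCommutativeMonoid _≡_ _·_ 𝟙
    residuation : ∀ x y z → (x · y ≤ z) ⇔ (x ≤ (y ⇒ z))
    T1 : ∀ x y → (P x ≤ y) ⇔ (x ≤ G y)
    T2 : ∀ x y → (F x ≤ y) ⇔ (x ≤ H y)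
    T3-G : G 𝟘 ≡ 𝟘
    T3-H : H 𝟘 ≡ 𝟘
    T4-G : ∀ x y → (G x · F y) ≤ F (x · y)
    T4-H : ∀ x y → (H x · P y) ≤ P (x · y)
    T5-G : ∀ x y → G (x ∨ y) ≤ (G x ∨ F y)
    T5-H : ∀ x y → H (x ∨ y) ≤ (H x ∨ P y)
    T6-G : ∀ x y → G (x ⇒ y) ≤ (G x ⇒ G y)
    T6-H : ∀ x y → H (x ⇒ y) ≤ (H x ⇒ H y)

module KC {ℓ} (L : TenseICRDL ℓ) where
  open TenseICRDL L

  Pair : Set ℓ
  Pair = Carrier × Carrier

  InK : Pair → Set ℓ
  InK (a , b) = a · b ≡ 𝟘

  _∨K_ : Pair → Pair → Pair
  (a , b) ∨K (x , y) = (a ∨ x , b ∧ y)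

  _∧K_ : Pair → Pair → Pair
  (a , b) ∧K (x , y) = (a ∧ x , b ∨ y)

  _*K_ : Pair → Pair → Pair
  (a , b) *K (x , y) = (a · x , (a ⇒ y) ∧ (x ⇒ b))

  ∼K : Pair → Pair
  ∼K (a , b) = (b , a)

  0K 1K cK : Pair
  0K = (𝟘 , 𝟙)
  1K = (𝟙 , 𝟘)
  cK = (𝟘 , 𝟘)

  GK HK FK PK : Pair → Pair
  GK (a , b) = (G a , F b)
  HK (a , b) = (H a , P b)
  FK (a , b) = (F a , G b)
  PK (a , b) = (P a , H b)

  infix 4 _≤K_
  _≤K_ : Pair → Pair → Set ℓ
  p ≤K q = p ∨K q ≡ q

  InC : Pair → Set ℓ
  InC p = InK p × (cK ≤K p)

  _∨C_ _∧C_ _·C_ _⇒C_ : Pair → Pair → Pair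
  p ∨C q = p ∨K q
  p ∧C q = p ∧K q
  p ·C q = (p *K q) ∨K cK
  p ⇒C q = ∼K (p *K (∼K q))

  0C 1C : Pair
  0C = cK
  1C = 1K

  GC HC FC PC : Pair → Pair
  GC = GK
  HC = HK
  FC = FK
  PC = PK

  α : Carrier → Pair
  α x = (x , 𝟘)

record IsAlphaIso {ℓ} (L : TenseICRDL ℓ) : Set ℓ where
  open TenseICRDL L
  open KC L
  field
    into      : ∀ x → InC (α x)
    pres-∨    : ∀ x y → α (x ∨ y) ≡ α x ∨C α y
    pres-∧    : ∀ x y → α (x ∧ y) ≡ α x ∧C α y
    pres-·    : ∀ x y → α (x · y) ≡ α x ·C α y
    pres-⇒    : ∀ x y → α (x ⇒ y) ≡ α x ⇒C α y
    pres-0    : α 𝟘 ≡ 0C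
    pres-1    : α 𝟙 ≡ 1C
    pres-G    : ∀ x → α (G x) ≡ GC (α x)
    pres-H    : ∀ x → α (H x) ≡ HC (α x)
    pres-F    : ∀ x → α (F x) ≡ FC (α x)
    pres-P    : ∀ x → α (P x) ≡ PC (α x)
    injective : ∀ x y → α x ≡ α y → x ≡ y
    surjective : ∀ p → InC p → Σ Carrier (λ x → α x ≡ p)

{-# OPTIONS --safe #-}
module Submission where

-- Every operation of C(K(L)) on pairs (x , 𝟘) produces, in its second
-- component, a term built from 𝟘 that collapses back to 𝟘 (𝟘 ∧ y, x · 𝟘,
-- F 𝟘, G 𝟘, …), while its first component is the operation of L itself up to
-- 𝟘 ⇒ 𝟘 = 𝟙.  Conversely c ≤ (a , b) forces b = 𝟘 ∧ b = 𝟘, so α is onto C(K(L)).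
-- The vanishing of F 𝟘, P 𝟘 and 𝟘 · y is one fact: left adjoints preserve 𝟘.

open import Defs
open import Level using (Level)
open import Data.Product using (_,_; proj₁; proj₂)
open import Function.Bundles using (_⇔_; Equivalence)
open import Relation.Binary.PropositionalEquality
open import Algebra.Core using (Op₂)
open import Algebra.Definitions using (Identity; LeftZero; RightZero)
open import Algebra.Structures using (IsCommutativeMonoid)
open import Algebra.Lattice.Bundles using (Lattice)
open import Algebra.Lattice.Structures using (IsDistributiveLattice; IsLattice)
import Algebra.Lattice.Properties.Lattice as LatticeProperties

module _ {a} {A : Set a} {_∨_ : Op₂ A} {⊥ : A} (∨-identity : Identity _≡_ ⊥ _∨_) where

  leftAdjoint-preserves-⊥ : ∀ {f g : A → A} →
                            (∀ x y → (f x ∨ y ≡ y) ⇔ (x ∨ g y ≡ g y)) → f ⊥ ≡ ⊥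
  leftAdjoint-preserves-⊥ {f} {g} f⊣g = begin
    f ⊥      ≡⟨ proj₂ ∨-identity (f ⊥) ⟨
    f ⊥ ∨ ⊥  ≡⟨ Equivalence.from (f⊣g ⊥ ⊥) (proj₁ ∨-identity (g ⊥)) ⟩
    ⊥        ∎
    where open ≡-Reasoning

module BoundedLatticeProperties
  {a} {A : Set a} {_∨_ _∧_ : Op₂ A} {⊥ ⊤ : A}
  (isLattice : IsLattice _≡_ _∨_ _∧_)
  (∨-identity : Identity _≡_ ⊥ _∨_) (∧-identity : Identity _≡_ ⊤ _∧_) where

  open IsLattice isLattice using (∧-comm; ∨-absorbs-∧; ∧-absorbs-∨)

  lattice : Lattice a a
  lattice = record { isLattice = isLattice }

  open LatticeProperties lattice public using (∨-idem; ∧-idem)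

  ∧-zeroˡ : LeftZero _≡_ ⊥ _∧_
  ∧-zeroˡ x = trans (cong (⊥ ∧_) (sym (proj₁ ∨-identity x))) (∧-absorbs-∨ ⊥ x)

  ∧-zeroʳ : RightZero _≡_ ⊥ _∧_
  ∧-zeroʳ x = trans (∧-comm x ⊥) (∧-zeroˡ x)

  ∨-zeroˡ : LeftZero _≡_ ⊤ _∨_
  ∨-zeroˡ x = trans (cong (⊤ ∨_) (sym (proj₁ ∧-identity x))) (∨-absorbs-∧ ⊤ x)

module TenseICRDLProperties {ℓ} (L : TenseICRDL ℓ) where

  open TenseICRDL L
  open IsDistributiveLattice isDistributiveLattice using (isLattice)
  open IsCommutativeMonoid isCommutativeMonoid using (comm; identityˡ)
  open BoundedLatticeProperties isLattice ∨-identity ∧-identity public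

  ·-zeroˡ : LeftZero _≡_ 𝟘 _·_
  ·-zeroˡ y = leftAdjoint-preserves-⊥ {_∨_ = _∨_} ∨-identity {f = _· y} (λ x z → residuation x y z)

  ·-zeroʳ : RightZero _≡_ 𝟘 _·_
  ·-zeroʳ x = trans (comm x 𝟘) (·-zeroˡ x)

  ⇒-refl : ∀ x → x ⇒ x ≡ 𝟙
  ⇒-refl x = begin
    x ⇒ x        ≡⟨ 𝟙≤x⇒x ⟨
    𝟙 ∨ (x ⇒ x)  ≡⟨ ∨-zeroˡ (x ⇒ x) ⟩
    𝟙            ∎
    where
    open ≡-Reasoning
    𝟙≤x⇒x : 𝟙 ≤ x ⇒ x
    𝟙≤x⇒x = Equivalence.to (residuation 𝟙 x x)
              (trans (cong (_∨ x) (identityˡ x)) (∨-idem x))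

  P-𝟘 : P 𝟘 ≡ 𝟘
  P-𝟘 = leftAdjoint-preserves-⊥ {_∨_ = _∨_} ∨-identity T1

  F-𝟘 : F 𝟘 ≡ 𝟘
  F-𝟘 = leftAdjoint-preserves-⊥ {_∨_ = _∨_} ∨-identity T2

  open KC L

  above-c⇒snd≡𝟘 : ∀ {a b} → cK ≤K (a , b) → b ≡ 𝟘
  above-c⇒snd≡𝟘 {b = b} c≤ab = trans (sym (cong proj₂ c≤ab)) (∧-zeroˡ b)

mainTheorem11 : ∀ {ℓ : Level} (L : TenseICRDL ℓ) → IsAlphaIso L
mainTheorem11 L = record
  { into       = λ x → ·-zeroʳ x , cong₂ _,_ (proj₁ ∨-identity x) (∧-idem 𝟘)
  ; pres-∨     = λ x y → cong (x ∨ y ,_) (sym (∧-idem 𝟘))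
  ; pres-∧     = λ x y → cong (x ∧ y ,_) (sym (∨-idem 𝟘))
  ; pres-·     = λ x y → sym (cong₂ _,_ (proj₂ ∨-identity (x · y)) (∧-zeroʳ _))
  ; pres-⇒     = λ x y → sym (cong₂ _,_ (⇒-conclusion x y) (·-zeroʳ x))
  ; pres-0     = refl
  ; pres-1     = refl
  ; pres-G     = λ x → cong (G x ,_) (sym F-𝟘)
  ; pres-H     = λ x → cong (H x ,_) (sym P-𝟘)
  ; pres-F     = λ x → cong (F x ,_) (sym T3-G)
  ; pres-P     = λ x → cong (P x ,_) (sym T3-H)
  ; injective  = λ x y → cong proj₁
  ; surjective = λ { (a , b) (_ , c≤ab) → a , cong (a ,_) (sym (above-c⇒snd≡𝟘 c≤ab)) }
  }
  where
  open TenseICRDL L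
  open TenseICRDLProperties L
  ⇒-conclusion : ∀ x y → (x ⇒ y) ∧ (𝟘 ⇒ 𝟘) ≡ x ⇒ y
  ⇒-conclusion x y = trans (cong ((x ⇒ y) ∧_) (⇒-refl 𝟘)) (proj₂ ∧-identity (x ⇒ y))
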